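{- For every binary matrix $M$, $\gamma(M)=\gamma(\mathrm{rd}(M))$, $\eta(M)=\eta(\mathrm{rd}(M))$, $\beta(M)=\beta(\mathrm{rd}(M))$, and $\zeta(M)=\zeta(\mathrm{rd}(M))$.
   Context: Binary matrices have no all-zero rows. $\mathrm{rd}(M)$ is the matrix obtained from $M$ by keeping exactly one copy of each set of identical columns. Conflict-free: no two columns $i,j$ and three distinct rows $r,r',r''$ with $(M_{r,i},M_{r,j})=(1,1),(M_{r',i},M_{r',j})=(1,0),(M_{r'',i},M_{r'',j})=(0,1)$. A row split of $M$ (rows $r_1,\dots,r_m$) is a binary matrix with the same number of columns whose rows partition into $R_1,\dots,R_m$ with $r_i$ the bitwise OR of $R_i$. $\gamma(M)$ (resp. $\eta(M)$) is the minimum number of rows (resp. distinct rows) of a conflict-free row split of $M$. The containment digraph $D_M$ has as vertices the distinct column supports (set of rows with a $1$ in the column) and arcs $(v,v')$ for $v\subsetneq v'$. A branching is a set $B$ of arcs with every vertex of out-degree at most $1$ in $B$. $r\in v$ is uncovered in $v$ if no arc $(v',v)\in B$ has $r\in v'$. $U(B)$: pairs $(r,v)$ with $r\in v$ uncovered in $v$; $I(B)$: vertices containing an uncovered element. $\beta(M)=\min_B|U(B)|$, $\zeta(M)=\min_B|I(B)|$. -}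

module Defs where

open import Data.Nat using (ℕ; zero; suc; _+_; _≤_)
open import Data.Bool using (Bool; true; false; _∧_; _∨_; not; if_then_else_)
open import Data.Bool.Properties using () renaming (_≟_ to _≟ᵇ_)
open import Data.Fin using (Fin; zero; suc)
import Data.Fin as F
open import Data.Maybe using (Maybe; just; nothing)
open import Data.List using (List; length; deduplicate)
open import Data.Vec using (Vec; lookup; toList; fromList; tabulate)
open import Data.Vec.Properties using (≡-dec)
open import Data.Product using (Σ; ∃; _×_; _,_)
open import Relation.Binary.PropositionalEquality using (_≡_; _≢_)
open import Relation.Nullary using (¬_; does)
open import Function.Bundles using (_⇔_)

-- A binary matrix with m rows and n columns, stored as a vector of its n columns;
-- each column is a vector of m bits (its support = rows carrying a 1).
Col : ℕ → Set
Col m = Vec Bool m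

Mat : ℕ → ℕ → Set
Mat m n = Vec (Col m) n

entry : ∀ {m n} → Mat m n → Fin m → Fin n → Bool
entry M r c = lookup (lookup M c) r

row : ∀ {m n} → Mat m n → Fin m → Vec Bool n
row M r = tabulate (λ c → entry M r c)

NoZeroRows : ∀ {m n} → Mat m n → Set
NoZeroRows {m} {n} M = ∀ (r : Fin m) → ∃ λ (c : Fin n) → entry M r c ≡ true

distinctCols : ∀ {m n} → Mat m n → List (Col m)
distinctCols M = deduplicate (≡-dec _≟ᵇ_) (toList M)

rdCols : ∀ {m n} → Mat m n → ℕ
rdCols M = length (distinctCols M)

rd : ∀ {m n} → (M : Mat m n) → Mat m (rdCols M)
rd M = fromList (distinctCols M)

ConflictFree : ∀ {m n} → Mat m n → Set
ConflictFree {m} {n} M =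
  ¬ (Σ (Fin n) λ i → Σ (Fin n) λ j → Σ (Fin m) λ r → Σ (Fin m) λ r' → Σ (Fin m) λ r'' →
       (entry M r i ≡ true  × entry M r j ≡ true)
     × (entry M r' i ≡ true × entry M r' j ≡ false)
     × (entry M r'' i ≡ false × entry M r'' j ≡ true))

-- A row split of M (m rows) with k rows: a binary matrix S (no zero rows) with the
-- same columns, together with the assignment f of each row of S to the block R_r
-- of the partition it belongs to, such that row r of M is the bitwise OR of R_r.
record RowSplit {m n : ℕ} (M : Mat m n) (k : ℕ) : Set where
  field
    S       : Mat k n
    nonzero : NoZeroRows S
    block   : Fin k → Fin m
    isOr    : ∀ (r : Fin m) (c : Fin n) →
              (entry M r c ≡ true) ⇔ (∃ λ (s : Fin k) → block s ≡ r × entry S s c ≡ true)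

distinctRows : ∀ {k n} → Mat k n → ℕ
distinctRows {k} S = length (deduplicate (≡-dec _≟ᵇ_) (toList (tabulate (row S))))

IsMin : (ℕ → Set) → ℕ → Set
IsMin P n = P n × (∀ k → P k → n ≤ k)

IsGamma : ∀ {m n} → Mat m n → ℕ → Set
IsGamma M = IsMin (λ k → Σ (RowSplit M k) λ R → ConflictFree (RowSplit.S R))

IsEta : ∀ {m n} → Mat m n → ℕ → Set
IsEta M = IsMin (λ d → Σ ℕ λ k → Σ (RowSplit M k) λ R →
                   ConflictFree (RowSplit.S R) × distinctRows (RowSplit.S R) ≡ d)

count : ∀ {k} → (Fin k → Bool) → ℕ
count {zero}  f = 0
count {suc k} f = (if f zero then 1 else 0) + count (λ i → f (suc i))

sumF : ∀ {k} → (Fin k → ℕ) → ℕ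
sumF {zero}  f = 0
sumF {suc k} f = f zero + sumF (λ i → f (suc i))

anyᵇ : ∀ {k} → (Fin k → Bool) → Bool
anyᵇ {zero}  f = false
anyᵇ {suc k} f = f zero ∨ anyᵇ (λ i → f (suc i))

-- containment digraph D_M: vertices are the distinct column supports
nV : ∀ {m n} → Mat m n → ℕ
nV M = rdCols M

vert : ∀ {m n} → (M : Mat m n) → Fin (nV M) → Col m
vert M i = lookup (rd M) i

_⊊_ : ∀ {m} → Col m → Col m → Set
_⊊_ {m} v w = (∀ (r : Fin m) → lookup v r ≡ true → lookup w r ≡ true) × v ≢ w

-- A branching: a set of arcs of D_M with out-degree ≤ 1 at every vertex, i.e. a
-- partial map sending v to the head of its unique out-arc (v, v'), v ⊊ v'.
record Branching {m n : ℕ} (M : Mat m n) : Set where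
  field
    out   : Fin (nV M) → Maybe (Fin (nV M))
    isArc : ∀ i j → out i ≡ just j → vert M i ⊊ vert M j

module _ {m n : ℕ} {M : Mat m n} (B : Branching M) where
  open Branching B

  isArcᵇ : Fin (nV M) → Fin (nV M) → Bool
  isArcᵇ i j with out i
  ... | nothing = false
  ... | just j' = does (j' F.≟ j)

  uncoveredᵇ : Fin m → Fin (nV M) → Bool
  uncoveredᵇ r v = lookup (vert M v) r ∧ not (anyᵇ (λ v' → isArcᵇ v' v ∧ lookup (vert M v') r))

  sizeU : ℕ
  sizeU = sumF (λ v → count (λ r → uncoveredᵇ r v))
  sizeI : ℕ
  sizeI = count (λ v → anyᵇ (λ r → uncoveredᵇ r v))

IsBeta : ∀ {m n} → Mat m n → ℕ → Set
IsBeta M = IsMin (λ k → Σ (Branching M) λ B → sizeU B ≡ k)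

IsZeta : ∀ {m n} → Mat m n → ℕ → Set
IsZeta M = IsMin (λ k → Σ (Branching M) λ B → sizeI B ≡ k)

-- β and ζ only depend on the list of distinct column supports, which is the same
-- for M and rd(M). For γ and η, a row split of one of the two matrices becomes a
-- row split of the other by giving each target column the split column of a source
-- column with the same support (the class of a column of M, or a representative of
-- a column of rd(M)). Selecting columns and repeating rows creates neither conflicts
-- nor new distinct rows. A row that becomes zero is replaced by a row of the same
-- block that stays nonzero; one exists because the target has no zero rows.
module Submission where

open import Defs
open import Data.Nat using (ℕ; zero; suc; _≤_; z≤n; s≤s; _+_)
open import Data.Nat.Properties using (≤-trans; ≤-refl; ≤-antisym; ≤-reflexive)
open import Data.Bool using (Bool; true; false; _∧_; _∨_; not)
open import Data.Bool.Properties using () renaming (_≟_ to _≟ᵇ_)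
open import Data.Fin using (Fin; zero; suc)
import Data.Fin as F
open import Data.Fin.Properties using (any?)
open import Data.Maybe using (Maybe; just; nothing)
open import Data.List as List using (List; []; _∷_; length; deduplicate)
open import Data.List.Properties using (filter-all; length-map)
open import Data.List.Relation.Unary.Any using (here; there)
import Data.List.Relation.Unary.All as All
open import Data.List.Relation.Unary.AllPairs using (_∷_)
open import Data.List.Relation.Unary.Unique.Propositional using (Unique)
open import Data.List.Relation.Unary.Unique.DecPropositional.Properties using (deduplicate-!)
open import Data.List.Relation.Binary.Subset.Propositional using (_⊆_)
open import Data.List.Membership.Propositional using (_∈_)
open import Data.List.Membership.Propositional.Properties
  using (∈-deduplicate⁺; ∈-deduplicate⁻; ∈-map⁺; ∈-map⁻)
open import Data.Vec using (Vec; lookup; toList; fromList; tabulate)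
open import Data.Vec.Properties using (≡-dec; toList∘fromList; lookup∘tabulate; tabulate-cong)
import Data.Vec.Relation.Unary.Any as VAny
open import Data.Vec.Relation.Unary.Any.Properties using (lookup-index)
open import Data.Vec.Membership.Propositional using () renaming (_∈_ to _∈ᵥ_)
open import Data.Vec.Membership.Propositional.Properties
  using (∈-lookup; ∈-tabulate⁺; ∈-toList⁺; ∈-toList⁻; ∈-fromList⁺; ∈-fromList⁻)
open import Data.Product using (Σ; ∃; _×_; _,_; proj₁; proj₂)
open import Relation.Binary.Definitions using (DecidableEquality)
open import Relation.Binary.PropositionalEquality
open import Relation.Nullary using (Dec; yes; no; does)
open import Data.Empty using (⊥-elim)
open import Function.Bundles using (_⇔_; mk⇔; Equivalence)

open Equivalence using (to; from)

_≼_ : (ℕ → Set) → (ℕ → Set) → Set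
P ≼ Q = ∀ k → P k → ∃ λ k' → k' ≤ k × Q k'

⇒-≼ : ∀ {P Q : ℕ → Set} → (∀ k → P k → Q k) → P ≼ Q
⇒-≼ P⇒Q k Pk = k , ≤-refl , P⇒Q k Pk

IsMin-cong : ∀ {P Q : ℕ → Set} → P ≼ Q → Q ≼ P → ∀ n → IsMin P n ⇔ IsMin Q n
IsMin-cong P≼Q Q≼P n = mk⇔ (transfer P≼Q Q≼P) (transfer Q≼P P≼Q)
  where
  transfer : ∀ {P Q : ℕ → Set} → P ≼ Q → Q ≼ P → IsMin P n → IsMin Q n
  transfer {Q = Q} P≼Q Q≼P (Pn , minimal) with k , k≤n , Qk ← P≼Q n Pn =
    subst Q (≤-antisym k≤n (lower Qk)) Qk , λ _ → lower
    where
    lower : ∀ {k} → Q k → n ≤ k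
    lower Qk' with k' , k'≤k , Pk' ← Q≼P _ Qk' = ≤-trans (minimal k' Pk') k'≤k

module _ {A : Set} where

  remove : ∀ {x : A} (ys : List A) → x ∈ ys → List A
  remove (y ∷ ys) (here _)  = ys
  remove (y ∷ ys) (there p) = y ∷ remove ys p

  length-remove : ∀ {x : A} (ys : List A) (p : x ∈ ys) → length ys ≡ suc (length (remove ys p))
  length-remove (y ∷ ys) (here _)  = refl
  length-remove (y ∷ ys) (there p) = cong suc (length-remove ys p)

  ∈-remove : ∀ {x y : A} (ys : List A) (p : x ∈ ys) → y ∈ ys → x ≢ y → y ∈ remove ys p
  ∈-remove (z ∷ ys) (here refl) (here refl) x≢y = ⊥-elim (x≢y refl)
  ∈-remove (z ∷ ys) (here refl) (there q)   x≢y = q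
  ∈-remove (z ∷ ys) (there p)   (here y≡z)  x≢y = here y≡z
  ∈-remove (z ∷ ys) (there p)   (there q)   x≢y = there (∈-remove ys p q x≢y)

  Unique-⊆⇒length≤ : ∀ {xs ys : List A} → Unique xs → xs ⊆ ys → length xs ≤ length ys
  Unique-⊆⇒length≤ {[]}     _         _    = z≤n
  Unique-⊆⇒length≤ {x ∷ xs} {ys} (x∉xs ∷ u) xs⊆ys
    rewrite length-remove ys (xs⊆ys (here refl)) =
    s≤s (Unique-⊆⇒length≤ u λ q →
      ∈-remove ys (xs⊆ys (here refl)) (xs⊆ys (there q)) (All.lookup x∉xs q))

  module _ (_≟_ : DecidableEquality A) where

    deduplicate-Unique : ∀ {xs : List A} → Unique xs → deduplicate _≟_ xs ≡ xs
    deduplicate-Unique {[]}     _          = refl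
    deduplicate-Unique {x ∷ xs} (x∉xs ∷ u) rewrite deduplicate-Unique u =
      cong (x ∷_) (filter-all _ x∉xs)

    length-deduplicate-⊆-map : ∀ {B : Set} (_≟ᴮ_ : DecidableEquality B) (g : B → A)
      {xs : List A} {ys : List B} → xs ⊆ List.map g ys →
      length (deduplicate _≟_ xs) ≤ length (deduplicate _≟ᴮ_ ys)
    length-deduplicate-⊆-map _≟ᴮ_ g {ys = ys} xs⊆gys =
      ≤-trans (Unique-⊆⇒length≤ (deduplicate-! _≟_ _) dedup⊆)
              (≤-reflexive (length-map g (deduplicate _≟ᴮ_ ys)))
      where
      dedup⊆ : deduplicate _≟_ _ ⊆ List.map g (deduplicate _≟ᴮ_ ys)
      dedup⊆ p with y , y∈ys , refl ← ∈-map⁻ g (xs⊆gys (∈-deduplicate⁻ _≟_ _ p)) =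
        ∈-map⁺ g (∈-deduplicate⁺ _≟ᴮ_ y∈ys)

∈-toList-tabulate⁻ : ∀ {A : Set} {k} (f : Fin k → A) {x} → x ∈ toList (tabulate f) → ∃ λ i → x ≡ f i
∈-toList-tabulate⁻ f p with q ← ∈-toList⁻ p =
  VAny.index q , trans (lookup-index q) (lookup∘tabulate f (VAny.index q))

distinctRows-≤ : ∀ {k k' n n'} (S : Mat k n) (T : Mat k' n') (g : Vec Bool n → Vec Bool n') →
                 (∀ t → ∃ λ s → row T t ≡ g (row S s)) → distinctRows T ≤ distinctRows S
distinctRows-≤ S T g rowT = length-deduplicate-⊆-map (≡-dec _≟ᵇ_) (≡-dec _≟ᵇ_) g rows⊆
  where
  rows⊆ : toList (tabulate (row T)) ⊆ List.map g (toList (tabulate (row S)))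
  rows⊆ p with t , refl ← ∈-toList-tabulate⁻ (row T) p with s , eq ← rowT t =
    subst (_∈ _) (sym eq) (∈-map⁺ g (∈-toList⁺ (∈-tabulate⁺ (row S) s)))

reindex : ∀ {k k' n n'} → Mat k n → (Fin k' → Fin k) → (Fin n' → Fin n) → Mat k' n'
reindex S σ τ = tabulate λ j → tabulate λ s → entry S (σ s) (τ j)

module _ {k k' n n'} (S : Mat k n) (σ : Fin k' → Fin k) (τ : Fin n' → Fin n) where

  entry-reindex : ∀ s j → entry (reindex S σ τ) s j ≡ entry S (σ s) (τ j)
  entry-reindex s j = trans (cong (λ col → lookup col s) (lookup∘tabulate _ j)) (lookup∘tabulate _ s)

  ConflictFree-reindex : ConflictFree S → ConflictFree (reindex S σ τ)
  ConflictFree-reindex cf (i , j , r , r' , r'' , (a , b) , (c , d) , (e , f)) =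
    cf (τ i , τ j , σ r , σ r' , σ r'' ,
        (back r i a , back r j b) , (back r' i c , back r' j d) , (back r'' i e , back r'' j f))
    where
    back : ∀ s j {x} → entry (reindex S σ τ) s j ≡ x → entry S (σ s) (τ j) ≡ x
    back s j = trans (sym (entry-reindex s j))

  distinctRows-reindex : distinctRows (reindex S σ τ) ≤ distinctRows S
  distinctRows-reindex = distinctRows-≤ S (reindex S σ τ) (λ v → tabulate (λ j → lookup v (τ j)))
    λ s → σ s , tabulate-cong λ j → trans (entry-reindex s j) (sym (lookup∘tabulate _ (τ j)))

module Restriction {m n n'} {M : Mat m n} {N : Mat m n'} (τ : Fin n' → Fin n)
                   (columns : ∀ j → lookup N j ≡ lookup M (τ j)) (N-nonzero : NoZeroRows N)
                   {k} (R : RowSplit M k) where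
  open RowSplit R

  entry-columns : ∀ r j → entry N r j ≡ entry M r (τ j)
  entry-columns r j = cong (λ col → lookup col r) (columns j)

  RestrictedNonzero : Fin k → Set
  RestrictedNonzero s = ∃ λ j → entry S s (τ j) ≡ true

  restrictedNonzero-in-block : ∀ r → ∃ λ s → block s ≡ r × RestrictedNonzero s
  restrictedNonzero-in-block r
    with c , Nrc ← N-nonzero r
    with s , s∈r , Ssc ← to (isOr r (τ c)) (trans (sym (entry-columns r c)) Nrc) =
    s , s∈r , c , Ssc

  replace : ∀ s → Dec (RestrictedNonzero s) → Fin k
  replace s (yes _) = s
  replace s (no _)  = proj₁ (restrictedNonzero-in-block (block s))

  restrictedNonzero? : ∀ s → Dec (RestrictedNonzero s)
  restrictedNonzero? s = any? λ j → entry S s (τ j) ≟ᵇ true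

  σ : Fin k → Fin k
  σ s = replace s (restrictedNonzero? s)

  σ-block : ∀ s → block (σ s) ≡ block s
  σ-block s with restrictedNonzero? s
  ... | yes _ = refl
  ... | no _  = proj₁ (proj₂ (restrictedNonzero-in-block (block s)))

  σ-restrictedNonzero : ∀ s → RestrictedNonzero (σ s)
  σ-restrictedNonzero s with restrictedNonzero? s
  ... | yes Sσs≢0 = Sσs≢0
  ... | no _      = proj₂ (proj₂ (restrictedNonzero-in-block (block s)))

  σ-fixes : ∀ s → RestrictedNonzero s → σ s ≡ s
  σ-fixes s Ss≢0 with restrictedNonzero? s
  ... | yes _     = refl
  ... | no Ss≡0  = ⊥-elim (Ss≡0 Ss≢0)

  restriction : RowSplit N k
  restriction = record
    { S       = reindex S σ τ
    ; nonzero = λ s → let j , Sσsj = σ-restrictedNonzero s in j , trans (entry-reindex S σ τ s j) Sσsj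
    ; block   = block
    ; isOr    = λ r j → mk⇔ (covered r j) (covering r j)
    }
    where
    covered : ∀ r j → entry N r j ≡ true → ∃ λ s → block s ≡ r × entry (reindex S σ τ) s j ≡ true
    covered r j Nrj with s , s∈r , Ssj ← to (isOr r (τ j)) (trans (sym (entry-columns r j)) Nrj) =
      s , s∈r , trans (entry-reindex S σ τ s j) (subst (λ s' → entry S s' (τ j) ≡ true)
                                                       (sym (σ-fixes s (j , Ssj))) Ssj)

    covering : ∀ r j → (∃ λ s → block s ≡ r × entry (reindex S σ τ) s j ≡ true) → entry N r j ≡ true
    covering r j (s , s∈r , Tsj) = trans (entry-columns r j)
      (from (isOr r (τ j)) (σ s , trans (σ-block s) s∈r , trans (sym (entry-reindex S σ τ s j)) Tsj))

ConflictFreeSplit : ∀ {m n} → Mat m n → ℕ → Set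
ConflictFreeSplit M k = Σ (RowSplit M k) λ R → ConflictFree (RowSplit.S R)

ConflictFreeSplitWithDistinctRows : ∀ {m n} → Mat m n → ℕ → Set
ConflictFreeSplitWithDistinctRows M d =
  Σ ℕ λ k → Σ (RowSplit M k) λ R → ConflictFree (RowSplit.S R) × distinctRows (RowSplit.S R) ≡ d

module _ {m n n'} {M : Mat m n} {N : Mat m n'} (τ : Fin n' → Fin n)
         (columns : ∀ j → lookup N j ≡ lookup M (τ j)) (N-nonzero : NoZeroRows N) where
  open Restriction {M = M} {N = N} τ columns N-nonzero

  ConflictFreeSplit-≼ : ConflictFreeSplit M ≼ ConflictFreeSplit N
  ConflictFreeSplit-≼ = ⇒-≼ λ k (R , cf) →
    restriction R , ConflictFree-reindex (RowSplit.S R) (σ R) τ cf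

  ConflictFreeSplitWithDistinctRows-≼ :
    ConflictFreeSplitWithDistinctRows M ≼ ConflictFreeSplitWithDistinctRows N
  ConflictFreeSplitWithDistinctRows-≼ d (k , R , cf , refl) =
    distinctRows (RowSplit.S (restriction R)) , distinctRows-reindex (RowSplit.S R) (σ R) τ ,
    k , restriction R , ConflictFree-reindex (RowSplit.S R) (σ R) τ cf , refl

module _ {m n} (M : Mat m n) where

  ∈-rd : ∀ c → lookup M c ∈ᵥ rd M
  ∈-rd c = ∈-fromList⁺ (∈-deduplicate⁺ (≡-dec _≟ᵇ_) (∈-toList⁺ (∈-lookup c M)))

  rd-∈ : ∀ j → lookup (rd M) j ∈ᵥ M
  rd-∈ j = ∈-toList⁻ (∈-deduplicate⁻ (≡-dec _≟ᵇ_) (toList M) (∈-fromList⁻ (∈-lookup j (rd M))))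

  classOf : Fin n → Fin (rdCols M)
  classOf c = VAny.index (∈-rd c)

  lookup-classOf : ∀ c → lookup M c ≡ lookup (rd M) (classOf c)
  lookup-classOf c = lookup-index (∈-rd c)

  representative : Fin (rdCols M) → Fin n
  representative j = VAny.index (rd-∈ j)

  lookup-representative : ∀ j → lookup (rd M) j ≡ lookup M (representative j)
  lookup-representative j = lookup-index (rd-∈ j)

  NoZeroRows-rd : NoZeroRows M → NoZeroRows (rd M)
  NoZeroRows-rd nonzero r with c , Mrc ← nonzero r =
    classOf c , trans (cong (λ col → lookup col r) (sym (lookup-classOf c))) Mrc

  distinctCols-rd : distinctCols (rd M) ≡ distinctCols M
  distinctCols-rd rewrite toList∘fromList (distinctCols M) =
    deduplicate-Unique (≡-dec _≟ᵇ_) (deduplicate-! (≡-dec _≟ᵇ_) (toList M))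

sumF-cong : ∀ {k} {f g : Fin k → ℕ} → (∀ i → f i ≡ g i) → sumF f ≡ sumF g
sumF-cong {zero}  f≗g = refl
sumF-cong {suc k} f≗g = cong₂ _+_ (f≗g zero) (sumF-cong (λ i → f≗g (suc i)))

count-cong : ∀ {k} {f g : Fin k → Bool} → (∀ i → f i ≡ g i) → count f ≡ count g
count-cong {zero}  f≗g = refl
count-cong {suc k} f≗g rewrite f≗g zero = cong (_ +_) (count-cong (λ i → f≗g (suc i)))

anyᵇ-cong : ∀ {k} {f g : Fin k → Bool} → (∀ i → f i ≡ g i) → anyᵇ f ≡ anyᵇ g
anyᵇ-cong {zero}  f≗g = refl
anyᵇ-cong {suc k} f≗g = cong₂ _∨_ (f≗g zero) (anyᵇ-cong (λ i → f≗g (suc i)))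

-- Branching M, sizeU and sizeI phrased through the column list alone; for
-- L = distinctCols M they agree with the originals up to the with in isArcᵇ.
module OnColumns {m} (L : List (Col m)) where

  vertex : Fin (length L) → Col m
  vertex = lookup (fromList L)

  record Branching′ : Set where
    field
      out   : Fin (length L) → Maybe (Fin (length L))
      isArc : ∀ i j → out i ≡ just j → vertex i ⊊ vertex j

  arcᵇ : Maybe (Fin (length L)) → Fin (length L) → Bool
  arcᵇ nothing   j = false
  arcᵇ (just j') j = does (j' F.≟ j)

  uncovered′ : Branching′ → Fin m → Fin (length L) → Bool
  uncovered′ B r v =
    lookup (vertex v) r ∧ not (anyᵇ (λ v' → arcᵇ (Branching′.out B v') v ∧ lookup (vertex v') r))

  sizeU′ sizeI′ : Branching′ → ℕ
  sizeU′ B = sumF (λ v → count (λ r → uncovered′ B r v))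
  sizeI′ B = count (λ v → anyᵇ (λ r → uncovered′ B r v))

module _ {m n} {M : Mat m n} where
  open OnColumns (distinctCols M)

  toColumns : Branching M → Branching′
  toColumns B = record { out = Branching.out B ; isArc = Branching.isArc B }

  fromColumns : Branching′ → Branching M
  fromColumns B = record { out = Branching′.out B ; isArc = Branching′.isArc B }

  uncovered-toColumns : ∀ B r v → uncoveredᵇ B r v ≡ uncovered′ (toColumns B) r v
  uncovered-toColumns B r v =
    cong (λ a → lookup (vertex v) r ∧ not a)
         (anyᵇ-cong λ v' → cong (_∧ lookup (vertex v') r) (isArc-arcᵇ v'))
    where
    isArc-arcᵇ : ∀ v' → isArcᵇ B v' v ≡ arcᵇ (Branching.out B v') v
    isArc-arcᵇ v' with Branching.out B v'
    ... | nothing = refl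
    ... | just _  = refl

  sizeU-toColumns : ∀ B → sizeU B ≡ sizeU′ (toColumns B)
  sizeU-toColumns B = sumF-cong λ v → count-cong λ r → uncovered-toColumns B r v

  sizeI-toColumns : ∀ B → sizeI B ≡ sizeI′ (toColumns B)
  sizeI-toColumns B = count-cong λ v → anyᵇ-cong λ r → uncovered-toColumns B r v

BranchingWithU BranchingWithI : ∀ {m n} → Mat m n → ℕ → Set
BranchingWithU M k = Σ (Branching M) λ B → sizeU B ≡ k
BranchingWithI M k = Σ (Branching M) λ B → sizeI B ≡ k

module _ {m n n'} {M : Mat m n} {N : Mat m n'} (same : distinctCols M ≡ distinctCols N) where
  open OnColumns using (Branching′; sizeU′; sizeI′)

  BranchingWithU-transfer : ∀ k → BranchingWithU M k → BranchingWithU N k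
  BranchingWithU-transfer k (B , size)
    with B′ , size′ ← subst (λ L → Σ (Branching′ L) λ B → sizeU′ L B ≡ k) same
                            (toColumns B , trans (sym (sizeU-toColumns B)) size) =
    fromColumns B′ , trans (sizeU-toColumns (fromColumns B′)) size′

  BranchingWithI-transfer : ∀ k → BranchingWithI M k → BranchingWithI N k
  BranchingWithI-transfer k (B , size)
    with B′ , size′ ← subst (λ L → Σ (Branching′ L) λ B → sizeI′ L B ≡ k) same
                            (toColumns B , trans (sym (sizeI-toColumns B)) size) =
    fromColumns B′ , trans (sizeI-toColumns (fromColumns B′)) size′

lemma5 : ∀ {m n : ℕ} (M : Mat m n) → NoZeroRows M → ∀ (k : ℕ) →
           (IsGamma M k ⇔ IsGamma (rd M) k)
         × (IsEta M k ⇔ IsEta (rd M) k)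
         × (IsBeta M k ⇔ IsBeta (rd M) k)
         × (IsZeta M k ⇔ IsZeta (rd M) k)
lemma5 M M-nonzero k =
    IsMin-cong (ConflictFreeSplit-≼ (representative M) (lookup-representative M) rd-nonzero)
               (ConflictFreeSplit-≼ (classOf M) (lookup-classOf M) M-nonzero) k
  , IsMin-cong (ConflictFreeSplitWithDistinctRows-≼ (representative M) (lookup-representative M) rd-nonzero)
               (ConflictFreeSplitWithDistinctRows-≼ (classOf M) (lookup-classOf M) M-nonzero) k
  , IsMin-cong (⇒-≼ (BranchingWithU-transfer (sym (distinctCols-rd M))))
               (⇒-≼ (BranchingWithU-transfer (distinctCols-rd M))) k
  , IsMin-cong (⇒-≼ (BranchingWithI-transfer (sym (distinctCols-rd M))))
               (⇒-≼ (BranchingWithI-transfer (distinctCols-rd M))) k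
  where
  rd-nonzero : NoZeroRows (rd M)
  rd-nonzero = NoZeroRows-rd M M-nonzero
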